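{- Let $k\geq 1$, $n=8k+3$, $G=C(n,\pm\{1,2,3,4\})$, and $a\in\mathbb{Z}_n$. If $X\subseteq V(G)$ resolves $A=(\{a,a+1\},\{a+3,a+4\})$ (indices mod $n$), then $|X|\geq 2$.
   Context: $C(n,\pm\{1,2,3,4\})$ is the graph on $\mathbb{Z}_n$ where distinct $i,j$ are adjacent iff $j-i\equiv\pm s\pmod n$ for some $s\in\{1,2,3,4\}$; $d$ is graph distance, and $r(v|X)=(d(v,x))_{x\in X}$. A set $X$ resolves a tuple of sets $(A_1,\dots,A_p)$ if $r(a|X)\neq r(b|X)$ for all distinct $a,b$ lying in the same $A_j$. -}

module Defs where

open import Data.Nat using (ℕ; zero; suc; _+_; _<_)
open import Data.Fin using (Fin; toℕ; fromℕ<)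
open import Data.Nat.DivMod using (_%_; m%n<n)
open import Data.Fin.Subset using (Subset; _∈_)
open import Data.Product using (Σ; ∃; _×_; _,_)
open import Data.Sum using (_⊎_)
open import Relation.Binary.PropositionalEquality using (_≡_; _≢_)
open import Relation.Nullary using (¬_)

-- Z_n represented by Fin n (n ≥ 1 written as suc m); arithmetic mod n.
_⊕_ : ∀ {m} → Fin (suc m) → ℕ → Fin (suc m)
_⊕_ {m} i s = fromℕ< (m%n<n (toℕ i + s) (suc m))

-- Circulant graph C(n, ±{1,2,3,4}): distinct i, j adjacent iff
-- j - i ≡ ±s (mod n) for some s ∈ {1,2,3,4}.
-- (j - i ≡ -s means i = j + s.)
data Step : Set where
  s1 s2 s3 s4 : Step

stepℕ : Step → ℕ
stepℕ s1 = 1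
stepℕ s2 = 2
stepℕ s3 = 3
stepℕ s4 = 4

Adj : ∀ {m} → Fin (suc m) → Fin (suc m) → Set
Adj i j = (i ≢ j) × (Σ Step λ s → (j ≡ i ⊕ stepℕ s) ⊎ (i ≡ j ⊕ stepℕ s))

data Walk {m} : Fin (suc m) → Fin (suc m) → ℕ → Set where
  here : ∀ {u} → Walk u u 0
  step : ∀ {u w v ℓ} → Adj u w → Walk w v ℓ → Walk u v (suc ℓ)

Dist : ∀ {m} → Fin (suc m) → Fin (suc m) → ℕ → Set
Dist u v d = Walk u v d × (∀ ℓ → ℓ < d → ¬ Walk u v ℓ)

Distinguishes : ∀ {m} → Subset (suc m) → Fin (suc m) → Fin (suc m) → Set
Distinguishes X a b =
  ∃ λ x → x ∈ X × ∃ λ da → ∃ λ db → Dist a x da × Dist b x db × da ≢ db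

-- X resolves the pair of sets ({a,a+1},{a+3,a+4}): the only distinct pairs
-- lying in a common set are {a,a+1} and {a+3,a+4} (these elements are distinct as n ≥ 5).
ResolvesA : ∀ {m} → Subset (suc m) → Fin (suc m) → Set
ResolvesA X a = Distinguishes X a (a ⊕ 1) × Distinguishes X (a ⊕ 3) (a ⊕ 4)

-- The distance from u to u + t in C(n, ±{1,2,3,4}) is ⌈min(t, n − t)/4⌉: walks along one arc
-- give the upper bound, and a walk of length ℓ from u ends at u + p − q for some p, q with
-- p + q ≤ 4ℓ.  Hence a vertex x has different distances to u and u + 1 only if, writing
-- x = u + 1 + t and n = t + 1 + t̄, the shorter of the two arcs t, t̄ has length divisible by 4.
-- For the pairs (a, a+1) and (a+3, a+4) the offsets of x differ by 3, and when n ≡ 3 (mod 4)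
-- no choice of x makes both pairs separated; so the two pairs need two different vertices of X.
module Submission where

open import Defs
open import Data.Nat using (ℕ; suc; _+_; _*_; _∸_; _≤_; _<_; _⊓_; z≤n; s≤s; s≤s⁻¹; NonZero; >-nonZero)
open import Data.Nat.Properties
  using (*-cancelʳ-<; *-monoʳ-≤; *-monoˡ-≤; +-assoc; +-cancelˡ-≡; +-cancelˡ-≤; +-comm;
        +-distribʳ-⊓; +-identityʳ; +-mono-<; +-mono-≤; +-monoʳ-<; +-monoʳ-≤; +-monoˡ-≤; +-suc;
        <-cmp; <-≤-trans; <⇒≢; <⇒≤; <⇒≱; m+[n∸m]≡n; m+n∸n≡m; m∸n+n≡m; m≤m+n; m≤n+m; m≤n⇒m≤1+n;
        m≤n⇒m⊓n≡m; m≥n⇒m⊓n≡n; m⊓n≤m; m⊓n≤n; n<1+n; n≤1+n; ∸-monoˡ-<; ≤-<-trans; ≤-antisym; ≤-refl;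
        ≤-trans; ≤∧≢⇒<; ≮⇒≥; ≰⇒>; ⊓-glb; _<?_; _≤?_; module ≤-Reasoning)
open import Data.Nat.DivMod using (_%_; %-distribˡ-+; m%n%n≡m%n; [m+n]%n≡m%n; m<n⇒m%n≡m; m≤n⇒[n∸m]%m≡n%m)
open import Data.Nat.Divisibility using (_∣_; divides; _∣?_; ∣m+n∣m⇒∣n; ∣m∣n⇒∣m+n; ∣⇒≤)
open import Data.Nat.Tactic.RingSolver using (solve-∀)
open import Data.Fin using (Fin; toℕ; _≟_)
open import Data.Fin.Properties using (toℕ-fromℕ<; toℕ-injective; toℕ<n)
open import Data.Fin.Subset using (Subset; ∣_∣; _∈_; ⁅_⁆)
open import Data.Fin.Subset.Properties using (p⊂q⇒∣p∣<∣q∣; ∣⁅x⁆∣≡1; x∈⁅y⁆⇒x≡y)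
open import Data.Product using (∃; ∃₂; _×_; _,_; proj₁)
open import Data.Sum using (_⊎_; inj₁; inj₂; swap; map)
open import Data.Empty using (⊥; ⊥-elim)
open import Function using (_∘_)
open import Relation.Binary.Definitions using (tri<; tri≈; tri>)
open import Relation.Binary.PropositionalEquality using (_≡_; _≢_; refl; sym; trans; cong; subst; module ≡-Reasoning)
open import Relation.Nullary using (¬_; yes; no; contradiction)
open import Relation.Nullary.Decidable using (from-no)

x≢y∈p⇒2≤∣p∣ : ∀ {n} {p : Subset n} {x y} → x ∈ p → y ∈ p → x ≢ y → 2 ≤ ∣ p ∣
x≢y∈p⇒2≤∣p∣ {p = p} {x} {y} x∈p y∈p x≢y =
  subst (_< ∣ p ∣) (∣⁅x⁆∣≡1 x) (p⊂q⇒∣p∣<∣q∣ (⁅x⁆⊆p , y , y∈p , x≢y ∘ sym ∘ x∈⁅y⁆⇒x≡y x))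
  where
  ⁅x⁆⊆p : ∀ {z} → z ∈ ⁅ x ⁆ → z ∈ p
  ⁅x⁆⊆p z∈⁅x⁆ = subst (_∈ p) (sym (x∈⁅y⁆⇒x≡y x z∈⁅x⁆)) x∈p

[m%d+n]%d≡[m+n]%d : ∀ m n d .{{_ : NonZero d}} → (m % d + n) % d ≡ (m + n) % d
[m%d+n]%d≡[m+n]%d m n d = begin
  (m % d + n) % d         ≡⟨ %-distribˡ-+ (m % d) n d ⟩
  (m % d % d + n % d) % d ≡⟨ cong (λ z → (z + n % d) % d) (m%n%n≡m%n m d) ⟩
  (m % d + n % d) % d     ≡⟨ %-distribˡ-+ m n d ⟨
  (m + n) % d             ∎
  where open ≡-Reasoning

[m+n%d]%d≡[m+n]%d : ∀ m n d .{{_ : NonZero d}} → (m + n % d) % d ≡ (m + n) % d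
[m+n%d]%d≡[m+n]%d m n d = begin
  (m + n % d) % d ≡⟨ cong (_% d) (+-comm m (n % d)) ⟩
  (n % d + m) % d ≡⟨ [m%d+n]%d≡[m+n]%d n m d ⟩
  (n + m) % d     ≡⟨ cong (_% d) (+-comm n m) ⟩
  (m + n) % d     ∎
  where open ≡-Reasoning

m<n+n⇒m%n≡m⊎m%n+n≡m : ∀ {m n} .{{_ : NonZero n}} → m < n + n → m % n ≡ m ⊎ m % n + n ≡ m
m<n+n⇒m%n≡m⊎m%n+n≡m {m} {n} m<n+n with m <? n
... | yes m<n = inj₁ (m<n⇒m%n≡m m<n)
... | no m≮n = inj₂ (trans (cong (_+ n) m%n≡m∸n) (m∸n+n≡m n≤m))
  where
  n≤m : n ≤ m
  n≤m = ≮⇒≥ m≮n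
  m%n≡m∸n : m % n ≡ m ∸ n
  m%n≡m∸n = trans (sym (m≤n⇒[n∸m]%m≡n%m n≤m))
                  (m<n⇒m%n≡m (subst (m ∸ n <_) (m+n∸n≡m n n) (∸-monoˡ-< m<n+n n≤m)))

CeilQuarter : ℕ → ℕ → Set
CeilQuarter t d = t ≤ d * 4 × d * 4 ≤ t + 3

ceilQuarter-least : ∀ {t d e} → CeilQuarter t d → t ≤ e * 4 → d ≤ e
ceilQuarter-least {t} {d} {e} (_ , d*4≤t+3) t≤e*4 = s≤s⁻¹ (*-cancelʳ-< 4 d (suc e) (begin-strict
  d * 4  ≤⟨ d*4≤t+3 ⟩
  t + 3  ≤⟨ +-monoˡ-≤ 3 t≤e*4 ⟩
  e * 4 + 3 <⟨ +-monoʳ-< (e * 4) (n<1+n 3) ⟩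
  e * 4 + 4 ≡⟨ +-comm (e * 4) 4 ⟩
  suc e * 4 ∎))
  where open ≤-Reasoning

ceilQuarter-unique : ∀ {t d e} → CeilQuarter t d → CeilQuarter t e → d ≡ e
ceilQuarter-unique cd ce = ≤-antisym (ceilQuarter-least cd (proj₁ ce)) (ceilQuarter-least ce (proj₁ cd))

ceilQuarter-jump : ∀ {t d e} → CeilQuarter t d → CeilQuarter (suc t) e → d ≢ e → 4 ∣ t
ceilQuarter-jump {t} {d} {e} cd@(t≤d*4 , _) (1+t≤e*4 , e*4≤t+4) d≢e =
  divides d (≤-antisym t≤d*4 (+-cancelˡ-≤ 4 (d * 4) t (begin
    suc d * 4 ≤⟨ *-monoˡ-≤ 4 d<e ⟩
    e * 4     ≤⟨ e*4≤t+4 ⟩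
    suc t + 3 ≡⟨ +-comm (suc t) 3 ⟩
    4 + t     ∎)))
  where
  open ≤-Reasoning
  d<e : d < e
  d<e = ≤∧≢⇒< (ceilQuarter-least cd (≤-trans (n≤1+n t) 1+t≤e*4)) d≢e

SeparatingOffset : ℕ → ℕ → Set
SeparatingOffset t t̄ = (t < t̄ × 4 ∣ t) ⊎ (t̄ < t × 4 ∣ t̄)

ceilQuarter-⊓-separating : ∀ {t t̄ d e} → CeilQuarter (suc t ⊓ t̄) d → CeilQuarter (t ⊓ suc t̄) e →
  d ≢ e → SeparatingOffset t t̄
ceilQuarter-⊓-separating {t} {t̄} {d} {e} cd ce d≢e with <-cmp t t̄
... | tri< t<t̄ _ _ = inj₁ (t<t̄ , ceilQuarter-jump
  (subst (λ z → CeilQuarter z e) (m≤n⇒m⊓n≡m (m≤n⇒m≤1+n (<⇒≤ t<t̄))) ce)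
  (subst (λ z → CeilQuarter z d) (m≤n⇒m⊓n≡m t<t̄) cd) (d≢e ∘ sym))
... | tri≈ _ refl _ = ⊥-elim (d≢e (ceilQuarter-unique
  (subst (λ z → CeilQuarter z d) (m≥n⇒m⊓n≡n (n≤1+n t)) cd)
  (subst (λ z → CeilQuarter z e) (m≤n⇒m⊓n≡m (n≤1+n t)) ce)))
... | tri> _ _ t̄<t = inj₂ (t̄<t , ceilQuarter-jump
  (subst (λ z → CeilQuarter z d) (m≥n⇒m⊓n≡n (m≤n⇒m≤1+n (<⇒≤ t̄<t))) cd)
  (subst (λ z → CeilQuarter z e) (m≥n⇒m⊓n≡n t̄<t) ce) d≢e)

¬separatingOffset-near : ∀ {t t̄} → 0 < t → t < 4 → t ≤ t̄ → ¬ SeparatingOffset t t̄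
¬separatingOffset-near 0<t t<4 t≤t̄ (inj₁ (_ , 4∣t)) = <⇒≱ t<4 (∣⇒≤ {{>-nonZero 0<t}} 4∣t)
¬separatingOffset-near 0<t t<4 t≤t̄ (inj₂ (t̄<t , _)) = <⇒≱ t̄<t t≤t̄

4∤1 : ¬ 4 ∣ 1
4∤1 = from-no (4 ∣? 1)

4∤3 : ¬ 4 ∣ 3
4∤3 = from-no (4 ∣? 3)

¬separatingOffsets-aligned : ∀ {n s t̄} → 4 ∣ n + 1 → suc (3 + s) + t̄ ≡ n →
  SeparatingOffset (3 + s) t̄ → ¬ SeparatingOffset s (3 + t̄)
¬separatingOffsets-aligned {s = s} _ _ (inj₁ (_ , 4∣3+s)) (inj₁ (_ , 4∣s)) =
  4∤3 (∣m+n∣m⇒∣n (subst (4 ∣_) (+-comm 3 s) 4∣3+s) 4∣s)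
¬separatingOffsets-aligned {t̄ = t̄} _ _ (inj₂ (_ , 4∣t̄)) (inj₂ (_ , 4∣3+t̄)) =
  4∤3 (∣m+n∣m⇒∣n (subst (4 ∣_) (+-comm 3 t̄) 4∣3+t̄) 4∣t̄)
¬separatingOffsets-aligned {s = s} {t̄} 4∣n+1 refl (inj₁ (_ , 4∣3+s)) (inj₂ (_ , 4∣3+t̄)) =
  4∤1 (∣m+n∣m⇒∣n (subst (4 ∣_) (sum-≡ s t̄) (∣m∣n⇒∣m+n 4∣3+s 4∣3+t̄)) 4∣n+1)
  where
  sum-≡ : ∀ s t̄ → (3 + s) + (3 + t̄) ≡ (suc (3 + s) + t̄ + 1) + 1
  sum-≡ = solve-∀
¬separatingOffsets-aligned {s = s} {t̄} 4∣n+1 refl (inj₂ (_ , 4∣t̄)) (inj₁ (_ , 4∣s)) =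
  4∤1 (∣m+n∣m⇒∣n (∣m+n∣m⇒∣n (subst (4 ∣_) (sum-≡ s t̄) 4∣n+1) (∣m∣n⇒∣m+n 4∣s 4∣t̄))
                  (divides 1 refl))
  where
  sum-≡ : ∀ s t̄ → suc (3 + s) + t̄ + 1 ≡ (s + t̄) + (4 + 1)
  sum-≡ = solve-∀

¬separatingOffsets-3-apart : ∀ {n t t̄ s s̄} → 5 ≤ n → 4 ∣ n + 1 → suc t + t̄ ≡ n → suc s + s̄ ≡ n →
  t ≡ 3 + s ⊎ t + n ≡ 3 + s → SeparatingOffset t t̄ → ¬ SeparatingOffset s s̄
¬separatingOffsets-3-apart {t̄ = t̄} {s} {s̄} _ 4∣n+1 t+t̄ s+s̄ (inj₁ refl) sep =
  ¬separatingOffsets-aligned 4∣n+1 t+t̄ sep ∘ subst (SeparatingOffset s) s̄≡3+t̄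
  where
  shift-3 : ∀ s t̄ → suc (3 + s) + t̄ ≡ suc s + (3 + t̄)
  shift-3 = solve-∀
  s̄≡3+t̄ : s̄ ≡ 3 + t̄
  s̄≡3+t̄ = +-cancelˡ-≡ (suc s) s̄ (3 + t̄) (trans s+s̄ (trans (sym t+t̄) (shift-3 s t̄)))
¬separatingOffsets-3-apart {t = 0} {s = s} (s≤s (s≤s (s≤s 2≤s))) _ _ s+s̄ (inj₂ refl) _ =
  ¬separatingOffset-near (s≤s z≤n) (s≤s (s≤s (s≤s z≤n))) 2≤s ∘ swap
    ∘ subst (SeparatingOffset s) (+-cancelˡ-≡ (suc s) _ 2 (trans s+s̄ (+-comm 2 (suc s))))
¬separatingOffsets-3-apart {t = 1} (s≤s (s≤s 3≤t̄)) _ refl _ (inj₂ _) sep =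
  contradiction sep (¬separatingOffset-near (s≤s z≤n) (s≤s (s≤s z≤n)) (≤-trans (s≤s z≤n) 3≤t̄))
¬separatingOffsets-3-apart {t = 2} (s≤s (s≤s (s≤s 2≤t̄))) _ refl _ (inj₂ _) sep =
  contradiction sep (¬separatingOffset-near (s≤s z≤n) (s≤s (s≤s (s≤s z≤n))) 2≤t̄)
¬separatingOffsets-3-apart {n} {t = suc (suc (suc t))} {s = s} {s̄} _ _ _ s+s̄ (inj₂ wrap) _ _ =
  <⇒≱ (subst (s <_) s+s̄ (m≤m+n (suc s) s̄))
      (subst (n ≤_) (+-cancelˡ-≡ 3 (t + n) s wrap) (m≤n+m n t))

stepℕ≤4 : ∀ s → stepℕ s ≤ 4
stepℕ≤4 s1 = s≤s z≤n
stepℕ≤4 s2 = s≤s (s≤s z≤n)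
stepℕ≤4 s3 = s≤s (s≤s (s≤s z≤n))
stepℕ≤4 s4 = ≤-refl

0<stepℕ : ∀ s → 0 < stepℕ s
0<stepℕ s1 = s≤s z≤n
0<stepℕ s2 = s≤s z≤n
0<stepℕ s3 = s≤s z≤n
0<stepℕ s4 = s≤s z≤n

module _ {m : ℕ} where

  private
    N : ℕ
    N = suc m

  toℕ-⊕ : ∀ (i : Fin N) s → toℕ (i ⊕ s) ≡ (toℕ i + s) % N
  toℕ-⊕ i s = toℕ-fromℕ< _

  ⊕-identityʳ : ∀ (i : Fin N) → i ⊕ 0 ≡ i
  ⊕-identityʳ i = toℕ-injective (begin
    toℕ (i ⊕ 0)     ≡⟨ toℕ-⊕ i 0 ⟩
    (toℕ i + 0) % N ≡⟨ cong (_% N) (+-identityʳ (toℕ i)) ⟩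
    toℕ i % N       ≡⟨ m<n⇒m%n≡m (toℕ<n i) ⟩
    toℕ i           ∎)
    where open ≡-Reasoning

  ⊕-assoc : ∀ (i : Fin N) s t → (i ⊕ s) ⊕ t ≡ i ⊕ (s + t)
  ⊕-assoc i s t = toℕ-injective (begin
    toℕ ((i ⊕ s) ⊕ t)         ≡⟨ toℕ-⊕ (i ⊕ s) t ⟩
    (toℕ (i ⊕ s) + t) % N     ≡⟨ cong (λ z → (z + t) % N) (toℕ-⊕ i s) ⟩
    ((toℕ i + s) % N + t) % N ≡⟨ [m%d+n]%d≡[m+n]%d (toℕ i + s) t N ⟩
    (toℕ i + s + t) % N       ≡⟨ cong (_% N) (+-assoc (toℕ i) s t) ⟩
    (toℕ i + (s + t)) % N     ≡⟨ toℕ-⊕ i (s + t) ⟨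
    toℕ (i ⊕ (s + t))         ∎)
    where open ≡-Reasoning

  ⊕-N : ∀ (i : Fin N) → i ⊕ N ≡ i
  ⊕-N i = toℕ-injective
    (trans (toℕ-⊕ i N) (trans ([m+n]%n≡m%n (toℕ i) N) (m<n⇒m%n≡m (toℕ<n i))))

  _⊖_ : Fin N → Fin N → ℕ
  x ⊖ a = toℕ (x ⊕ (N ∸ toℕ a))

  private
    a+[s+[N∸a]]≡s+N : ∀ (a : Fin N) s → toℕ a + (s + (N ∸ toℕ a)) ≡ s + N
    a+[s+[N∸a]]≡s+N a s = begin
      toℕ a + (s + (N ∸ toℕ a)) ≡⟨ cong (toℕ a +_) (+-comm s _) ⟩
      toℕ a + ((N ∸ toℕ a) + s) ≡⟨ +-assoc (toℕ a) _ s ⟨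
      toℕ a + (N ∸ toℕ a) + s   ≡⟨ cong (_+ s) (m+[n∸m]≡n (<⇒≤ (toℕ<n a))) ⟩
      N + s                     ≡⟨ +-comm N s ⟩
      s + N                     ∎
      where open ≡-Reasoning

  ⊕-⊖ : ∀ (a x : Fin N) → a ⊕ (x ⊖ a) ≡ x
  ⊕-⊖ a x = toℕ-injective (begin
    toℕ (a ⊕ (x ⊖ a))                         ≡⟨ toℕ-⊕ a (x ⊖ a) ⟩
    (toℕ a + toℕ (x ⊕ (N ∸ toℕ a))) % N       ≡⟨ cong (λ z → (toℕ a + z) % N) (toℕ-⊕ x _) ⟩
    (toℕ a + (toℕ x + (N ∸ toℕ a)) % N) % N   ≡⟨ [m+n%d]%d≡[m+n]%d (toℕ a) _ N ⟩
    (toℕ a + (toℕ x + (N ∸ toℕ a))) % N       ≡⟨ cong (_% N) (a+[s+[N∸a]]≡s+N a (toℕ x)) ⟩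
    (toℕ x + N) % N                           ≡⟨ [m+n]%n≡m%n (toℕ x) N ⟩
    toℕ x % N                                 ≡⟨ m<n⇒m%n≡m (toℕ<n x) ⟩
    toℕ x                                     ∎)
    where open ≡-Reasoning

  a⊕s⊖a≡s%N : ∀ (a : Fin N) s → (a ⊕ s) ⊖ a ≡ s % N
  a⊕s⊖a≡s%N a s = begin
    toℕ ((a ⊕ s) ⊕ (N ∸ toℕ a)) ≡⟨ cong toℕ (⊕-assoc a s _) ⟩
    toℕ (a ⊕ (s + (N ∸ toℕ a))) ≡⟨ toℕ-⊕ a _ ⟩
    (toℕ a + (s + (N ∸ toℕ a))) % N ≡⟨ cong (_% N) (a+[s+[N∸a]]≡s+N a s) ⟩
    (s + N) % N                 ≡⟨ [m+n]%n≡m%n s N ⟩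
    s % N                       ∎
    where open ≡-Reasoning

  ⊕-cancelˡ : ∀ (a : Fin N) {s t} → a ⊕ s ≡ a ⊕ t → s % N ≡ t % N
  ⊕-cancelˡ a {s} {t} eq = trans (sym (a⊕s⊖a≡s%N a s)) (trans (cong (_⊖ a) eq) (a⊕s⊖a≡s%N a t))

  ⊕-cancelˡ-< : ∀ (a : Fin N) {s t} → s < N → t < N → a ⊕ s ≡ a ⊕ t → s ≡ t
  ⊕-cancelˡ-< a s<N t<N eq = trans (sym (m<n⇒m%n≡m s<N)) (trans (⊕-cancelˡ a eq) (m<n⇒m%n≡m t<N))

  Adj-sym : ∀ {u v : Fin N} → Adj u v → Adj v u
  Adj-sym (u≢v , s , inj₁ v≡u⊕s) = u≢v ∘ sym , s , inj₂ v≡u⊕s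
  Adj-sym (u≢v , s , inj₂ u≡v⊕s) = u≢v ∘ sym , s , inj₁ u≡v⊕s

  Walk-snoc : ∀ {u v w : Fin N} {ℓ} → Walk u v ℓ → Adj v w → Walk u w (suc ℓ)
  Walk-snoc here        adj = step adj here
  Walk-snoc (step a w) adj = step a (Walk-snoc w adj)

  Walk-reverse : ∀ {u v : Fin N} {ℓ} → Walk u v ℓ → Walk v u ℓ
  Walk-reverse here       = here
  Walk-reverse (step a w) = Walk-snoc (Walk-reverse w) (Adj-sym a)

  Dist⇒≤ : ∀ {u v : Fin N} {d ℓ} → Dist u v d → Walk u v ℓ → d ≤ ℓ
  Dist⇒≤ (_ , shortest) w = ≮⇒≥ (λ ℓ<d → shortest _ ℓ<d w)

  ⊕-offsets-trans : ∀ {u w v : Fin N} {p q p′ q′} → u ⊕ p ≡ w ⊕ q → w ⊕ p′ ≡ v ⊕ q′ →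
    u ⊕ (p + p′) ≡ v ⊕ (q + q′)
  ⊕-offsets-trans {u} {w} {v} {p} {q} {p′} {q′} u⊕p≡w⊕q w⊕p′≡v⊕q′ = begin
    u ⊕ (p + p′)   ≡⟨ ⊕-assoc u p p′ ⟨
    (u ⊕ p) ⊕ p′   ≡⟨ cong (_⊕ p′) u⊕p≡w⊕q ⟩
    (w ⊕ q) ⊕ p′   ≡⟨ ⊕-assoc w q p′ ⟩
    w ⊕ (q + p′)   ≡⟨ cong (w ⊕_) (+-comm q p′) ⟩
    w ⊕ (p′ + q)   ≡⟨ ⊕-assoc w p′ q ⟨
    (w ⊕ p′) ⊕ q   ≡⟨ cong (_⊕ q) w⊕p′≡v⊕q′ ⟩
    (v ⊕ q′) ⊕ q   ≡⟨ ⊕-assoc v q′ q ⟩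
    v ⊕ (q′ + q)   ≡⟨ cong (v ⊕_) (+-comm q′ q) ⟩
    v ⊕ (q + q′)   ∎
    where open ≡-Reasoning

  Adj⇒offsets : ∀ {u w : Fin N} → Adj u w → ∃₂ λ p q → p + q ≤ 4 × u ⊕ p ≡ w ⊕ q
  Adj⇒offsets {u} {w} (_ , s , inj₁ w≡u⊕s) =
    stepℕ s , 0 , subst (_≤ 4) (sym (+-identityʳ _)) (stepℕ≤4 s) ,
    trans (sym w≡u⊕s) (sym (⊕-identityʳ w))
  Adj⇒offsets {u} (_ , s , inj₂ u≡w⊕s) = 0 , stepℕ s , stepℕ≤4 s , trans (⊕-identityʳ u) u≡w⊕s

  Walk⇒offsets : ∀ {u v : Fin N} {ℓ} → Walk u v ℓ → ∃₂ λ p q → p + q ≤ ℓ * 4 × u ⊕ p ≡ v ⊕ q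
  Walk⇒offsets here = 0 , 0 , z≤n , refl
  Walk⇒offsets {u} {v} (step {w = w} {ℓ = ℓ} adj rest) with Adj⇒offsets adj | Walk⇒offsets rest
  ... | p , q , p+q≤4 , e | p′ , q′ , p′+q′≤ℓ*4 , e′ =
    p + p′ , q + q′ , subst (_≤ 4 + ℓ * 4) (interchange p q p′ q′) (+-mono-≤ p+q≤4 p′+q′≤ℓ*4) ,
    ⊕-offsets-trans {u} {w} {v} e e′
    where
    interchange : ∀ p q p′ q′ → (p + q) + (p′ + q′) ≡ (p + p′) + (q + q′)
    interchange = solve-∀

  offsets⇒⊓≤ : ∀ (u : Fin N) {t t̄ p q} → t + t̄ ≡ N → u ⊕ p ≡ (u ⊕ t) ⊕ q → t ⊓ t̄ ≤ p + q
  offsets⇒⊓≤ u {t} {t̄} {p} {q} t+t̄ u⊕p≡u⊕t⊕q with t ⊓ t̄ ≤? p + q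
  ... | yes ⊓≤p+q = ⊓≤p+q
  ... | no ⊓≰p+q = ⊥-elim (<⇒≱ p+q<t (begin
    t     ≤⟨ m≤m+n t q ⟩
    t + q ≡⟨ p≡t+q ⟨
    p     ≤⟨ m≤m+n p q ⟩
    p + q ∎))
    where
    open ≤-Reasoning
    p+q<t : p + q < t
    p+q<t = <-≤-trans (≰⇒> ⊓≰p+q) (m⊓n≤m t t̄)
    p+q<t̄ : p + q < t̄
    p+q<t̄ = <-≤-trans (≰⇒> ⊓≰p+q) (m⊓n≤n t t̄)
    p<N : p < N
    p<N = ≤-<-trans (m≤m+n p q) (<-≤-trans p+q<t (subst (t ≤_) t+t̄ (m≤m+n t t̄)))
    t+q<N : t + q < N
    t+q<N = subst (t + q <_) t+t̄ (+-monoʳ-< t (≤-<-trans (m≤n+m q p) p+q<t̄))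
    p≡t+q : p ≡ t + q
    p≡t+q = ⊕-cancelˡ-< u p<N t+q<N (trans u⊕p≡u⊕t⊕q (⊕-assoc u t q))

  module _ (4≤m : 4 ≤ m) where

    ⊕-stepℕ-Adj : ∀ (i : Fin N) s → Adj i (i ⊕ stepℕ s)
    ⊕-stepℕ-Adj i s = i≢i⊕s , s , inj₁ refl
      where
      i≢i⊕s : i ≢ i ⊕ stepℕ s
      i≢i⊕s i≡i⊕s = <⇒≢ (0<stepℕ s)
        (⊕-cancelˡ-< i (s≤s z≤n) (s≤s (≤-trans (stepℕ≤4 s) 4≤m)) (trans (⊕-identityʳ i) i≡i⊕s))

    Walk-⊕ : ∀ (u : Fin N) c → ∃ λ ℓ → ℓ * 4 ≤ c + 3 × Walk u (u ⊕ c) ℓ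
    Walk-⊕ u 0 = 0 , z≤n , subst (λ v → Walk u v 0) (sym (⊕-identityʳ u)) here
    Walk-⊕ u 1 = 1 , ≤-refl , step (⊕-stepℕ-Adj u s1) here
    Walk-⊕ u 2 = 1 , n≤1+n 4 , step (⊕-stepℕ-Adj u s2) here
    Walk-⊕ u 3 = 1 , m≤m+n 4 2 , step (⊕-stepℕ-Adj u s3) here
    Walk-⊕ u 4 = 1 , m≤m+n 4 3 , step (⊕-stepℕ-Adj u s4) here
    Walk-⊕ u (suc (suc (suc (suc (suc c))))) with Walk-⊕ (u ⊕ 4) (suc c)
    ... | ℓ , ℓ*4≤c+4 , w =
      suc ℓ , +-monoʳ-≤ 4 ℓ*4≤c+4 ,
      step (⊕-stepℕ-Adj u s4) (subst (λ v → Walk (u ⊕ 4) v ℓ) (⊕-assoc u 4 (suc c)) w)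

    Dist⇒ceilQuarter : ∀ (u : Fin N) {t t̄ d} → t + t̄ ≡ N → Dist u (u ⊕ t) d → CeilQuarter (t ⊓ t̄) d
    Dist⇒ceilQuarter u {t} {t̄} {d} t+t̄ D@(shortest , _) = lower , upper
      where
      lower : t ⊓ t̄ ≤ d * 4
      lower with Walk⇒offsets shortest
      ... | p , q , p+q≤d*4 , e = ≤-trans (offsets⇒⊓≤ u t+t̄ e) p+q≤d*4
      forward : d * 4 ≤ t + 3
      forward with Walk-⊕ u t
      ... | ℓ , ℓ*4≤t+3 , w = ≤-trans (*-monoˡ-≤ 4 (Dist⇒≤ D w)) ℓ*4≤t+3
      u⊕t⊕t̄≡u : (u ⊕ t) ⊕ t̄ ≡ u
      u⊕t⊕t̄≡u = trans (⊕-assoc u t t̄) (trans (cong (u ⊕_) t+t̄) (⊕-N u))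
      backward : d * 4 ≤ t̄ + 3
      backward with Walk-⊕ (u ⊕ t) t̄
      ... | ℓ , ℓ*4≤t̄+3 , w = ≤-trans (*-monoˡ-≤ 4 (Dist⇒≤ D w⁻¹)) ℓ*4≤t̄+3
        where
        w⁻¹ : Walk u (u ⊕ t) ℓ
        w⁻¹ = Walk-reverse (subst (λ v → Walk (u ⊕ t) v ℓ) u⊕t⊕t̄≡u w)
      upper : d * 4 ≤ t ⊓ t̄ + 3
      upper = subst (d * 4 ≤_) (sym (+-distribʳ-⊓ 3 t t̄)) (⊓-glb forward backward)

    separatingOffset : ∀ {u v x : Fin N} {t t̄ d e} → v ≡ u ⊕ 1 → x ≡ v ⊕ t → suc t + t̄ ≡ N →
      Dist u x d → Dist v x e → d ≢ e → SeparatingOffset t t̄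
    separatingOffset {u} {t = t} {t̄} refl refl 1+t+t̄ Du Dv d≢e = ceilQuarter-⊓-separating
      (Dist⇒ceilQuarter u 1+t+t̄ (subst (λ y → Dist u y _) (⊕-assoc u 1 t) Du))
      (Dist⇒ceilQuarter (u ⊕ 1) (trans (+-suc t t̄) 1+t+t̄) Dv)
      d≢e

    no-vertex-separates-both : 4 ∣ N + 1 → ∀ (a x : Fin N) {da db dc dd} →
      Dist a x da → Dist (a ⊕ 1) x db → da ≢ db → Dist (a ⊕ 3) x dc → Dist (a ⊕ 4) x dd → dc ≢ dd → ⊥
    no-vertex-separates-both 4∣N+1 a x Da Db da≢db Dc Dd dc≢dd =
      ¬separatingOffsets-3-apart (s≤s 4≤m) 4∣N+1 (complement t<N) (complement s<N) t≡3+s-mod-N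
        (separatingOffset refl (sym (⊕-⊖ (a ⊕ 1) x)) (complement t<N) Da Db da≢db)
        (separatingOffset (sym (⊕-assoc a 3 1)) (sym (⊕-⊖ (a ⊕ 4) x)) (complement s<N) Dc Dd dc≢dd)
      where
      t s : ℕ
      t = x ⊖ (a ⊕ 1)
      s = x ⊖ (a ⊕ 4)
      t<N : t < N
      t<N = toℕ<n _
      s<N : s < N
      s<N = toℕ<n _
      complement : ∀ {r} → r < N → suc r + (m ∸ r) ≡ N
      complement r<N = cong suc (m+[n∸m]≡n (s≤s⁻¹ r<N))
      t≡[3+s]%N : t ≡ (3 + s) % N
      t≡[3+s]%N = trans (sym (m<n⇒m%n≡m t<N)) (⊕-cancelˡ (a ⊕ 1) (begin
        (a ⊕ 1) ⊕ t       ≡⟨ ⊕-⊖ (a ⊕ 1) x ⟩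
        x                 ≡⟨ ⊕-⊖ (a ⊕ 4) x ⟨
        (a ⊕ 4) ⊕ s       ≡⟨ cong (_⊕ s) (⊕-assoc a 1 3) ⟨
        ((a ⊕ 1) ⊕ 3) ⊕ s ≡⟨ ⊕-assoc (a ⊕ 1) 3 s ⟩
        (a ⊕ 1) ⊕ (3 + s) ∎))
        where open ≡-Reasoning
      t≡3+s-mod-N : t ≡ 3 + s ⊎ t + N ≡ 3 + s
      t≡3+s-mod-N = map (trans t≡[3+s]%N) (trans (cong (_+ N) t≡[3+s]%N))
        (m<n+n⇒m%n≡m⊎m%n+n≡m (+-mono-< (m≤n⇒m≤1+n 4≤m) s<N))

lemma3p26 : (k : ℕ) → 1 ≤ k → (a : Fin (suc (8 * k + 2))) → (X : Subset (suc (8 * k + 2)))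
    → ResolvesA X a → 2 ≤ ∣ X ∣
lemma3p26 k 1≤k a X ((x , x∈X , _ , _ , Da , Db , da≢db) , (y , y∈X , _ , _ , Dc , Dd , dc≢dd))
  with x ≟ y
... | no x≢y = x≢y∈p⇒2≤∣p∣ x∈X y∈X x≢y
... | yes refl = ⊥-elim (no-vertex-separates-both 4≤8k+2 4∣8k+4 a x Da Db da≢db Dc Dd dc≢dd)
  where
  4≤8k+2 : 4 ≤ 8 * k + 2
  4≤8k+2 = ≤-trans (m≤m+n 4 4) (≤-trans (*-monoʳ-≤ 8 1≤k) (m≤m+n (8 * k) 2))
  8k+4≡[2k+1]*4 : ∀ k → suc (8 * k + 2) + 1 ≡ (2 * k + 1) * 4
  8k+4≡[2k+1]*4 = solve-∀
  4∣8k+4 : 4 ∣ suc (8 * k + 2) + 1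
  4∣8k+4 = divides (2 * k + 1) (8k+4≡[2k+1]*4 k)
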